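{- Let $G$ be a graph with minimum degree $\delta(G)\ge 2$. Then $\operatorname{z_+ir}(G)\ge 2$.
   Context: Graphs are finite, simple, undirected. A (standard) fort is a nonempty $F\subseteq V(G)$ with $|F\cap N(v)|\ne1$ for all $v\in V(G)\setminus F$ ($N(v)$ the open neighborhood); a nonempty $F\subseteq V(G)$ is a PSD fort if the vertex set of each connected component of the induced subgraph $G[F]$ is a standard fort of $G$. $S\subseteq V(G)$ is a $\operatorname{Z}_+$Ir-set if each $u\in S$ has a PSD fort $F$ with $S\cap F=\{u\}$. $\operatorname{z_+ir}(G)$ is the minimum cardinality of a maximal (w.r.t. inclusion) $\operatorname{Z}_+$Ir-set of $G$. -}

module Defs where

open import Data.Nat using (ℕ; _≤_; _<_)
open import Data.Bool using (Bool; true; false)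
open import Data.Fin using (Fin)
open import Data.Fin.Subset using (Subset; _∈_; _∉_; _∩_; _⊆_; ∣_∣; Nonempty)
open import Data.Vec using (tabulate)
open import Data.Product using (Σ; _×_)
open import Relation.Binary.PropositionalEquality using (_≡_; _≢_)
open import Relation.Nullary using (¬_)
open import Function.Bundles using (_⇔_)

record Graph : Set where
  field
    n       : ℕ
    adj     : Fin n → Fin n → Bool
    sym     : ∀ u v → adj u v ≡ adj v u
    irrefl  : ∀ v → adj v v ≡ false
open Graph public

N : (G : Graph) → Fin (n G) → Subset (n G)
N G v = tabulate (adj G v)

deg : (G : Graph) → Fin (n G) → ℕ
deg G v = ∣ N G v ∣

MinDegGe : Graph → ℕ → Set
MinDegGe G k = ∀ v → k ≤ deg G v

IsFort : (G : Graph) → Subset (n G) → Set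
IsFort G F = Nonempty F × (∀ v → v ∉ F → ∣ F ∩ N G v ∣ ≢ 1)

data ReachIn (G : Graph) (F : Subset (n G)) : Fin (n G) → Fin (n G) → Set where
  here : ∀ {u} → u ∈ F → ReachIn G F u u
  step : ∀ {u v w} → ReachIn G F u v → adj G v w ≡ true → w ∈ F → ReachIn G F u w

-- PSD fort: nonempty, and the vertex set of every connected component of G[F]
-- (the component containing u, for each u ∈ F) is a standard fort of G
IsPSDFort : (G : Graph) → Subset (n G) → Set
IsPSDFort G F =
  Nonempty F ×
  (∀ u → u ∈ F → (C : Subset (n G)) → (∀ w → (w ∈ C) ⇔ ReachIn G F u w) → IsFort G C)

IsZIrSet : (G : Graph) → Subset (n G) → Set
IsZIrSet G S =
  ∀ u → u ∈ S → Σ (Subset (n G)) λ F → IsPSDFort G F × (∀ w → (w ∈ S × w ∈ F) ⇔ (w ≡ u))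

IsMaximalZIrSet : (G : Graph) → Subset (n G) → Set
IsMaximalZIrSet G S = IsZIrSet G S × (∀ T → S ⊆ T → IsZIrSet G T → T ≡ S)

-- z+ir(G) ≥ k  :⇔  every maximal Z+Ir-set has cardinality ≥ k
-- (z+ir is the minimum such cardinality; maximal Z+Ir-sets exist since ∅ is one and G is finite)
ZIrGe : Graph → ℕ → Set
ZIrGe G k = ∀ S → IsMaximalZIrSet G S → k ≤ ∣ S ∣

-- A Z₊Ir-set of size at most one is never maximal. Every vertex v lies in a PSD fort (its
-- connected component), so ∅ extends to {v}. For {u} we need a vertex v and two PSD forts
-- separating u from v. For an edge pa, the branch of a at p (the component of G − p
-- containing a) is a PSD fort as soon as it contains ≠ 1 neighbours of p. Starting from
-- p = u, either the branches of a at p and of u at a are both such forts, or minimum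
-- degree 2 yields a neighbour b of a whose branch at a is strictly inside that of a at p,
-- and we descend with (a, b) in place of (p, a). Throughout, u is joined to p outside
-- the branch of a at p, which keeps u out of that branch.
module Submission where

open import Defs renaming (sym to adj-sym)
open import Level using (0ℓ)
open import Data.Nat using (ℕ; suc; _<_; _≤_; z≤n; s≤s)
open import Data.Nat.Properties using (≤-trans; ≤-reflexive; ≤-<-trans; <⇒≢; ≤⇒≯; 0≢1+n)
  renaming (_≟_ to _≟ℕ_)
open import Data.Nat.Induction using (<-wellFounded)
open import Data.Bool using (Bool; true)
open import Data.Bool.Properties using (T-≡) renaming (_≟_ to _≟𝔹_)
open import Data.Empty using (⊥-elim)
open import Data.Fin using (Fin; fromℕ<; _≟_)
open import Data.Fin.Properties using (any?)
open import Data.Fin.Subset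
open import Data.Fin.Subset.Properties
open import Data.Vec using (tabulate)
open import Data.Vec.Properties using (lookup∘tabulate; []=⇒lookup; lookup⇒[]=)
open import Data.Product using (Σ; ∃; _×_; _,_)
open import Data.Sum using (_⊎_; inj₁; inj₂; [_,_]′) renaming (map to map⊎)
open import Function using (_∘_; id)
open import Function.Bundles using (_⇔_; mk⇔; Equivalence)
open import Induction.WellFounded using (module All)
open import Relation.Binary.Construct.On using (wellFounded)
open import Relation.Binary.PropositionalEquality using (_≡_; _≢_; refl; sym; trans; cong; subst)
open import Relation.Nullary using (Dec; yes; no; ¬_; contradiction)
open import Relation.Nullary.Decidable using (_×-dec_; ¬?; isYes; toWitness; fromWitness)
  renaming (map to mapDec)

open Equivalence using (to; from)

private
  variable
    m : ℕ
    p q : Subset m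
    x y : Fin m

x∈p⇒0<∣p∣ : x ∈ p → 0 < ∣ p ∣
x∈p⇒0<∣p∣ x∈p = ≤-<-trans z≤n (x∈p⇒∣p-x∣<∣p∣ x∈p)

∣p∣≡0⇒x∉p : ∣ p ∣ ≡ 0 → x ∉ p
∣p∣≡0⇒x∉p ∣p∣≡0 x∈p = <⇒≢ (x∈p⇒0<∣p∣ x∈p) (sym ∣p∣≡0)

∣p∣≡1⇒nonempty : ∣ p ∣ ≡ 1 → Nonempty p
∣p∣≡1⇒nonempty {m} {p} ∣p∣≡1 with nonempty? p
... | yes ne = ne
... | no empty = ⊥-elim (0≢1+n (trans (sym (∣⊥∣≡0 m)) (trans (cong ∣_∣ (sym (Empty-unique empty))) ∣p∣≡1)))

Empty⇒∣p∣≢1 : Empty p → ∣ p ∣ ≢ 1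
Empty⇒∣p∣≢1 empty = empty ∘ ∣p∣≡1⇒nonempty

∣p∣≡1⇒x≡y : ∣ p ∣ ≡ 1 → x ∈ p → y ∈ p → x ≡ y
∣p∣≡1⇒x≡y {x = x} {y = y} ∣p∣≡1 x∈p y∈p with y ≟ x
... | yes y≡x = sym y≡x
... | no y≢x = contradiction (sym ∣p∣≡1) (<⇒≢ 1<∣p∣)
  where
  1<∣p∣ : 1 < _
  1<∣p∣ = ≤-trans (s≤s (x∈p⇒0<∣p∣ (x∈p∧x≢y⇒x∈p-y y∈p y≢x))) (x∈p⇒∣p-x∣<∣p∣ x∈p)

∣p∣≡1⇒p≡⁅x⁆ : ∣ p ∣ ≡ 1 → x ∈ p → p ≡ ⁅ x ⁆
∣p∣≡1⇒p≡⁅x⁆ {p = p} {x = x} ∣p∣≡1 x∈p = ⊆-antisym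
  (λ y∈p → subst (_∈ ⁅ x ⁆) (∣p∣≡1⇒x≡y ∣p∣≡1 x∈p y∈p) (x∈⁅x⁆ x))
  (λ y∈⁅x⁆ → subst (_∈ p) (sym (x∈⁅y⁆⇒x≡y x y∈⁅x⁆)) x∈p)

2≤∣p∣⇒∃≢ : 2 ≤ ∣ p ∣ → (y : Fin m) → ∃ λ x → x ∈ p × x ≢ y
2≤∣p∣⇒∃≢ {p = p} 2≤∣p∣ y with any? (λ x → (x ∈? p) ×-dec ¬? (x ≟ y))
... | yes found = found
... | no none = contradiction (s≤s ∣p∣≤1) (≤⇒≯ 2≤∣p∣)
  where
  p⊆⁅y⁆ : p ⊆ ⁅ y ⁆
  p⊆⁅y⁆ {x} x∈p with x ≟ y
  ... | yes refl = x∈⁅x⁆ x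
  ... | no x≢y = contradiction (x , x∈p , x≢y) none
  ∣p∣≤1 : ∣ p ∣ ≤ 1
  ∣p∣≤1 = ≤-trans (p⊆q⇒∣p∣≤∣q∣ p⊆⁅y⁆) (≤-reflexive (∣⁅x⁆∣≡1 y))

2≤∣q∣∧∣p∩q∣≡1⇒∃∉p : 2 ≤ ∣ q ∣ → ∣ p ∩ q ∣ ≡ 1 → ∃ λ x → x ∈ q × x ∉ p
2≤∣q∣∧∣p∩q∣≡1⇒∃∉p {q = q} {p = p} 2≤∣q∣ ∣p∩q∣≡1 with ∣p∣≡1⇒nonempty ∣p∩q∣≡1
... | y , y∈p∩q with 2≤∣p∣⇒∃≢ 2≤∣q∣ y
...   | x , x∈q , x≢y = x , x∈q , λ x∈p → x≢y (∣p∣≡1⇒x≡y ∣p∩q∣≡1 (x∈p∩q⁺ (x∈p , x∈q)) y∈p∩q)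

∈-tabulate : {f : Fin m → Bool} → x ∈ tabulate f ⇔ f x ≡ true
∈-tabulate {x = x} {f = f} = mk⇔
  (λ x∈ → trans (sym (lookup∘tabulate f x)) ([]=⇒lookup x∈))
  (λ fx → lookup⇒[]= x _ (trans (lookup∘tabulate f x) fx))

module _ (G : Graph) where

  private
    V : Set
    V = Fin (n G)

    variable
      F C D : Subset (n G)
      a b u v w : V

  _~_ : V → V → Set
  x ~ y = adj G x y ≡ true

  ~-irrefl : ¬ (x ~ x)
  ~-irrefl {x} x~x = contradiction (trans (sym x~x) (irrefl G x)) λ ()

  ~⇒≢ : x ~ y → x ≢ y
  ~⇒≢ x~y refl = ~-irrefl x~y

  ~-sym : x ~ y → y ~ x
  ~-sym {x} {y} x~y = trans (adj-sym G y x) x~y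

  ∈N⇔~ : y ∈ N G x ⇔ x ~ y
  ∈N⇔~ = ∈-tabulate

  reach-start∈ : ReachIn G F x y → x ∈ F
  reach-start∈ (here x∈F) = x∈F
  reach-start∈ (step r _ _) = reach-start∈ r

  reach-end∈ : ReachIn G F x y → y ∈ F
  reach-end∈ (here y∈F) = y∈F
  reach-end∈ (step _ _ y∈F) = y∈F

  reach-trans : ReachIn G F x y → ReachIn G F y w → ReachIn G F x w
  reach-trans r (here _) = r
  reach-trans r (step s e w∈F) = step (reach-trans r s) e w∈F

  reach-∷ : x ∈ F → x ~ y → ReachIn G F y w → ReachIn G F x w
  reach-∷ x∈F x~y r = reach-trans (step (here x∈F) x~y (reach-start∈ r)) r

  reach-sym : ReachIn G F x y → ReachIn G F y x
  reach-sym (here x∈F) = here x∈F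
  reach-sym (step r e y∈F) = reach-∷ y∈F (~-sym e) (reach-sym r)

  reach-mono : F ⊆ D → ReachIn G F x y → ReachIn G D x y
  reach-mono F⊆D (here x∈F) = here (F⊆D x∈F)
  reach-mono F⊆D (step r e y∈F) = step (reach-mono F⊆D r) e (F⊆D y∈F)

  reach-uncons : ReachIn G F x w → x ≡ w ⊎ ∃ λ y → x ~ y × ReachIn G (F - x) y w
  reach-uncons (here _) = inj₁ refl
  reach-uncons {x = x} (step {w = w} r e w∈F) with reach-uncons r
  ... | inj₁ refl = inj₂ (w , e , here (x∈p∧x≢y⇒x∈p-y w∈F (~⇒≢ e ∘ sym)))
  ... | inj₂ (y , x~y , r′) with w ≟ x
  ...   | yes refl = inj₁ refl
  ...   | no w≢x = inj₂ (y , x~y , step r′ e (x∈p∧x≢y⇒x∈p-y w∈F w≢x))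

  reach-cons : x ∈ F → (∃ λ y → x ~ y × ReachIn G (F - x) y w) → ReachIn G F x w
  reach-cons {F = F} x∈F (y , x~y , r) = reach-∷ x∈F x~y (reach-mono (p─q⊆p F _) r)

  -- Recursion on ∣ F ∣: a path from x leaving x continues inside F - x.
  reach? : ∀ F x w → Dec (ReachIn G F x w)
  reach? = All.wfRec (wellFounded ∣_∣ <-wellFounded) 0ℓ _ decide
    where
    decide : ∀ F → (∀ {D} → ∣ D ∣ < ∣ F ∣ → ∀ x w → Dec (ReachIn G D x w)) →
             ∀ x w → Dec (ReachIn G F x w)
    decide F rec x w with x ∈? F
    ... | no x∉F = no (x∉F ∘ reach-start∈)
    ... | yes x∈F with x ≟ w
    ...   | yes refl = yes (here x∈F)
    ...   | no x≢w = mapDec (mk⇔ (reach-cons x∈F) ([ (λ x≡w → contradiction x≡w x≢w) , id ]′ ∘ reach-uncons))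
                        (any? λ y → (adj G x y ≟𝔹 true) ×-dec rec (x∈p⇒∣p-x∣<∣p∣ x∈F) y w)

  Component : Subset (n G) → V → Subset (n G) → Set
  Component F a C = ∀ w → (w ∈ C) ⇔ ReachIn G F a w

  component : Subset (n G) → V → Subset (n G)
  component F a = tabulate (λ w → isYes (reach? F a w))

  component-isComponent : ∀ F a → Component F a (component F a)
  component-isComponent F a w = mk⇔
    (λ w∈ → toWitness (from T-≡ (to ∈-tabulate w∈)))
    (λ r → from ∈-tabulate (to T-≡ (fromWitness r)))

  component-unique : Component F a C → Component F a D → C ≡ D
  component-unique C≈ D≈ = ⊆-antisym
    (λ {w} w∈C → from (D≈ w) (to (C≈ w) w∈C))
    (λ {w} w∈D → from (C≈ w) (to (D≈ w) w∈D))

  component-closed : Component F a C → y ∈ F → y ∉ C → Empty (C ∩ N G y)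
  component-closed {C = C} C≈ y∈F y∉C (z , z∈C∩Ny) with x∈p∩q⁻ C _ z∈C∩Ny
  ... | z∈C , z∈Ny = y∉C (from (C≈ _) (step (to (C≈ z) z∈C) (~-sym (to ∈N⇔~ z∈Ny)) y∈F))

  reach-within : Component F a C → ReachIn G F a x → ReachIn G F x w → ReachIn G C x w
  reach-within C≈ a⇝x (here _) = here (from (C≈ _) a⇝x)
  reach-within C≈ a⇝x (step r e w∈F) =
    step (reach-within C≈ a⇝x r) e (from (C≈ _) (reach-trans a⇝x (step r e w∈F)))

  component-connected : Component F a C → x ∈ C → Component C x C
  component-connected C≈ x∈C w = mk⇔
    (λ w∈C → reach-within C≈ (to (C≈ _) x∈C) (reach-trans (reach-sym (to (C≈ _) x∈C)) (to (C≈ w) w∈C)))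
    reach-end∈

  -- Only vertices outside F can see exactly one vertex of a component of G[F].
  component-isPSDFort : Component F a C → a ∈ F → (∀ y → y ∉ F → ∣ C ∩ N G y ∣ ≢ 1) →
                        IsPSDFort G C
  component-isPSDFort {F = F} {C = C} C≈ a∈F boundary = nonempty , λ x x∈C D D≈ →
    subst (IsFort G) (component-unique (component-connected C≈ x∈C) D≈) (nonempty , isFort)
    where
    nonempty : Nonempty C
    nonempty = _ , from (C≈ _) (here a∈F)
    isFort : ∀ y → y ∉ C → ∣ C ∩ N G y ∣ ≢ 1
    isFort y y∉C with y ∈? F
    ... | yes y∈F = Empty⇒∣p∣≢1 (component-closed C≈ y∈F y∉C)
    ... | no y∉F = boundary y y∉F

  component-⊤-isPSDFort : ∀ v → IsPSDFort G (component ⊤ v)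
  component-⊤-isPSDFort v = component-isPSDFort (component-isComponent ⊤ v) ∈⊤ λ _ y∉⊤ → contradiction ∈⊤ y∉⊤

  branch : V → V → Subset (n G)
  branch p a = component (∁ ⁅ p ⁆) a

  ∈branch⇔ : w ∈ branch v a ⇔ ReachIn G (∁ ⁅ v ⁆) a w
  ∈branch⇔ = component-isComponent _ _ _

  ≢⇒∈∁⁅⁆ : x ≢ y → x ∈ ∁ ⁅ y ⁆
  ≢⇒∈∁⁅⁆ = x∉p⇒x∈∁p ∘ x≢y⇒x∉⁅y⁆

  ∉branch : v ∉ branch v a
  ∉branch v∈ = x∈∁p⇒x∉p (reach-end∈ (to ∈branch⇔ v∈)) (x∈⁅x⁆ _)

  ∈branch : a ≢ v → a ∈ branch v a
  ∈branch a≢v = from ∈branch⇔ (here (≢⇒∈∁⁅⁆ a≢v))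

  branch-isPSDFort : a ≢ v → ∣ branch v a ∩ N G v ∣ ≢ 1 → IsPSDFort G (branch v a)
  branch-isPSDFort {a} {v} a≢v ≢1 = component-isPSDFort (component-isComponent _ _) (≢⇒∈∁⁅⁆ a≢v)
    λ y y∉ → subst (λ y → ∣ branch v a ∩ N G y ∣ ≢ 1) (sym (x∈⁅y⁆⇒x≡y _ (x∉∁p⇒x∈p y∉))) ≢1

  -- A path from b avoiding a is a path from a avoiding v, unless it first reaches v
  -- from a vertex of branch v a.
  branch-⊆ : a ≢ v → b ≢ v → a ~ b →
             (∀ w → w ∈ branch a b → w ∈ branch v a → ¬ w ~ v) → branch a b ⊆ branch v a
  branch-⊆ {a} {v} {b} a≢v b≢v a~b blocked = from ∈branch⇔ ∘ lift ∘ to ∈branch⇔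
    where
    lift : ReachIn G (∁ ⁅ a ⁆) b w → ReachIn G (∁ ⁅ v ⁆) a w
    lift (here _) = step (here (≢⇒∈∁⁅⁆ a≢v)) a~b (≢⇒∈∁⁅⁆ b≢v)
    lift (step {w = w} r e _) with w ≟ v
    ... | yes refl = contradiction e (blocked _ (from ∈branch⇔ r) (from ∈branch⇔ (lift r)))
    ... | no w≢v = step (lift r) e (≢⇒∈∁⁅⁆ w≢v)

  record Separation (u v : V) : Set where
    field
      Fᵤ Fᵥ  : Subset (n G)
      Fᵤ-psd : IsPSDFort G Fᵤ
      u∈Fᵤ   : u ∈ Fᵤ
      v∉Fᵤ   : v ∉ Fᵤ
      Fᵥ-psd : IsPSDFort G Fᵥ
      v∈Fᵥ   : v ∈ Fᵥ
      u∉Fᵥ   : u ∉ Fᵥ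

  Separation-sym : Separation u v → Separation v u
  Separation-sym s = record
    { Fᵤ = Fᵥ ; Fᵥ = Fᵤ ; Fᵤ-psd = Fᵥ-psd ; u∈Fᵤ = v∈Fᵥ ; v∉Fᵤ = u∉Fᵥ
    ; Fᵥ-psd = Fᵤ-psd ; v∈Fᵥ = u∈Fᵤ ; u∉Fᵥ = v∉Fᵤ }
    where open Separation s

  Separation⇒≢ : Separation u v → u ≢ v
  Separation⇒≢ s refl = v∉Fᵤ u∈Fᵤ
    where open Separation s

  module Descent (δ≥2 : MinDegGe G 2) (u : V) where

    data Frontier : Set where
      frontier : ∀ {p a} → p ~ a → ReachIn G (∁ (branch p a)) u p → Frontier

    size : Frontier → ℕ
    size (frontier {p} {a} _ _) = ∣ branch p a ∣

    initial : Frontier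
    initial with 2≤∣p∣⇒∃≢ (δ≥2 u) u
    ... | _ , a∈Nu , _ = frontier (to ∈N⇔~ a∈Nu) (here (x∉p⇒x∈∁p ∉branch))

    advance : ∀ {p a b} (p~a : p ~ a) (u⇝p : ReachIn G (∁ (branch p a)) u p) →
              a ~ b → b ≢ p → (∀ w → w ∈ branch a b → w ∈ branch p a → ¬ w ~ p) →
              Σ Frontier λ c → size c < size (frontier p~a u⇝p)
    advance {p} {a} {b} p~a u⇝p a~b b≢p blocked =
      frontier a~b (step (reach-mono ∁-shrinks u⇝p) p~a (x∉p⇒x∈∁p ∉branch)) ,
      p⊂q⇒∣p∣<∣q∣ (shrinks , a , ∈branch (~⇒≢ (~-sym p~a)) , ∉branch)
      where
      shrinks : branch a b ⊆ branch p a
      shrinks = branch-⊆ (~⇒≢ (~-sym p~a)) b≢p a~b blocked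
      ∁-shrinks : ∁ (branch p a) ⊆ ∁ (branch a b)
      ∁-shrinks w∈ = x∉p⇒x∈∁p (x∈∁p⇒x∉p w∈ ∘ shrinks)

    -- a is the only neighbour of p in branch p a, and a ∉ branch a b.
    advance-pendant : ∀ {p a} (p~a : p ~ a) (u⇝p : ReachIn G (∁ (branch p a)) u p) →
                      ∣ branch p a ∩ N G p ∣ ≡ 1 → Σ Frontier λ c → size c < size (frontier p~a u⇝p)
    advance-pendant {p} {a} p~a u⇝p one with 2≤∣p∣⇒∃≢ (δ≥2 a) p
    ... | b , b∈Na , b≢p = advance p~a u⇝p (to ∈N⇔~ b∈Na) b≢p blocked
      where
      blocked : ∀ w → w ∈ branch a b → w ∈ branch p a → ¬ w ~ p
      blocked w w∈ w∈′ w~p = ∉branch (subst (_∈ branch a b) (∣p∣≡1⇒x≡y one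
        (x∈p∩q⁺ (w∈′ , from ∈N⇔~ (~-sym w~p)))
        (x∈p∩q⁺ (∈branch (~⇒≢ (~-sym p~a)) , from ∈N⇔~ p~a))) w∈)

    -- p lies in branch a u, which b avoids; so nothing reachable from b in G − a sees p.
    advance-past : ∀ {p a} (p~a : p ~ a) (u⇝p : ReachIn G (∁ (branch p a)) u p) →
                   ∣ branch a u ∩ N G a ∣ ≡ 1 → Σ Frontier λ c → size c < size (frontier p~a u⇝p)
    advance-past {p} {a} p~a u⇝p one with 2≤∣q∣∧∣p∩q∣≡1⇒∃∉p (δ≥2 a) one
    ... | b , b∈Na , b∉ = advance p~a u⇝p (to ∈N⇔~ b∈Na) b≢p blocked
      where
      u⇝p∖a : ReachIn G (∁ ⁅ a ⁆) u p
      u⇝p∖a = reach-mono (λ w∈ → ≢⇒∈∁⁅⁆ λ { refl → x∈∁p⇒x∉p w∈ (∈branch (~⇒≢ (~-sym p~a))) }) u⇝p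
      b≢p : b ≢ p
      b≢p refl = b∉ (from ∈branch⇔ u⇝p∖a)
      blocked : ∀ w → w ∈ branch a b → w ∈ branch p a → ¬ w ~ p
      blocked w w∈ _ w~p = b∉ (from ∈branch⇔
        (reach-trans u⇝p∖a (reach-sym (step (to ∈branch⇔ w∈) w~p (reach-end∈ u⇝p∖a)))))

    branches-separate : ∀ {p a} → p ~ a → u ∉ branch p a →
                        ∣ branch p a ∩ N G p ∣ ≢ 1 → ∣ branch a u ∩ N G a ∣ ≢ 1 → Separation u a
    branches-separate {p} {a} p~a u∉ ≢1 ≢1′ = record
      { Fᵤ = branch a u ; Fᵥ = branch p a
      ; Fᵤ-psd = branch-isPSDFort u≢a ≢1′ ; u∈Fᵤ = ∈branch u≢a ; v∉Fᵤ = ∉branch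
      ; Fᵥ-psd = branch-isPSDFort a≢p ≢1 ; v∈Fᵥ = ∈branch a≢p ; u∉Fᵥ = u∉ }
      where
      a≢p : a ≢ p
      a≢p = ~⇒≢ (~-sym p~a)
      u≢a : u ≢ a
      u≢a refl = u∉ (∈branch a≢p)

    step-frontier : (c : Frontier) → ∃ (Separation u) ⊎ Σ Frontier λ c′ → size c′ < size c
    step-frontier (frontier {p} {a} p~a u⇝p) with ∣ branch p a ∩ N G p ∣ ≟ℕ 1
    ... | yes one = inj₂ (advance-pendant p~a u⇝p one)
    ... | no ≢1 with ∣ branch a u ∩ N G a ∣ ≟ℕ 1
    ...   | yes one′ = inj₂ (advance-past p~a u⇝p one′)
    ...   | no ≢1′ = inj₁ (a , branches-separate p~a (x∈∁p⇒x∉p (reach-start∈ u⇝p)) ≢1 ≢1′)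

    separate : ∃ (Separation u)
    separate = All.wfRec (wellFounded size <-wellFounded) 0ℓ _
      (λ c rec → [ id , (λ (c′ , smaller) → rec {c′} smaller) ]′ (step-frontier c)) initial

  singleton-isZIrSet : IsPSDFort G F → v ∈ F → IsZIrSet G ⁅ v ⁆
  singleton-isZIrSet {F = F} {v} F-psd v∈F x x∈⁅v⁆ = F , F-psd , λ w → mk⇔
    (λ (w∈⁅v⁆ , _) → trans (x∈⁅y⁆⇒x≡y v w∈⁅v⁆) (sym (x∈⁅y⁆⇒x≡y v x∈⁅v⁆)))
    (λ { refl → x∈⁅v⁆ , subst (_∈ F) (sym (x∈⁅y⁆⇒x≡y v x∈⁅v⁆)) v∈F })

  ∈-pair : w ∈ ⁅ u ⁆ ∪ ⁅ v ⁆ → w ≡ u ⊎ w ≡ v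
  ∈-pair {u = u} {v = v} w∈ = map⊎ (x∈⁅y⁆⇒x≡y u) (x∈⁅y⁆⇒x≡y v) (x∈p∪q⁻ _ _ w∈)

  Separation-isolates : (s : Separation u v) → ∀ w → (w ∈ ⁅ u ⁆ ∪ ⁅ v ⁆ × w ∈ Separation.Fᵤ s) ⇔ w ≡ u
  Separation-isolates s w = mk⇔
    (λ (w∈ , w∈Fᵤ) → [ id , (λ { refl → contradiction w∈Fᵤ v∉Fᵤ }) ]′ (∈-pair w∈))
    (λ { refl → x∈p∪q⁺ (inj₁ (x∈⁅x⁆ _)) , u∈Fᵤ })
    where open Separation s

  pair-isZIrSet : Separation u v → IsZIrSet G (⁅ u ⁆ ∪ ⁅ v ⁆)
  pair-isZIrSet s x x∈ with ∈-pair x∈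
  ... | inj₁ refl = _ , Separation.Fᵤ-psd s , Separation-isolates s
  ... | inj₂ refl = _ , Separation.Fᵥ-psd s ,
    subst (λ T → ∀ w → (w ∈ T × _) ⇔ _) (∪-comm _ _) (Separation-isolates (Separation-sym s))

  empty-notMaximal : V → ¬ IsMaximalZIrSet G ⊥
  empty-notMaximal v (_ , maximal) = ∉⊥ (subst (v ∈_) (maximal ⁅ v ⁆ ⊥⊆ ⁅v⁆-isZIr) (x∈⁅x⁆ v))
    where
    ⁅v⁆-isZIr : IsZIrSet G ⁅ v ⁆
    ⁅v⁆-isZIr = singleton-isZIrSet (component-⊤-isPSDFort v) (from (component-isComponent ⊤ v v) (here ∈⊤))

  singleton-notMaximal : MinDegGe G 2 → ¬ IsMaximalZIrSet G ⁅ u ⁆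
  singleton-notMaximal {u} δ≥2 (_ , maximal) with Descent.separate δ≥2 u
  ... | v , s = Separation⇒≢ s (sym (x∈⁅y⁆⇒x≡y u v∈⁅u⁆))
    where
    v∈⁅u⁆ : v ∈ ⁅ u ⁆
    v∈⁅u⁆ = subst (v ∈_) (maximal _ (p⊆p∪q _) (pair-isZIrSet s)) (x∈p∪q⁺ (inj₂ (x∈⁅x⁆ v)))

proposition3p20 : (G : Graph) → 0 < n G → MinDegGe G 2 → ZIrGe G 2
proposition3p20 G 0<n δ≥2 S S-max with ∣ S ∣ in ∣S∣≡
... | 0 = contradiction (subst (IsMaximalZIrSet G) S≡⊥ S-max) (empty-notMaximal G (fromℕ< 0<n))
  where
  S≡⊥ : S ≡ ⊥
  S≡⊥ = Empty-unique λ (x , x∈S) → ∣p∣≡0⇒x∉p ∣S∣≡ x∈S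
... | suc (suc _) = s≤s (s≤s z≤n)
... | 1 with ∣p∣≡1⇒nonempty ∣S∣≡
...   | u , u∈S = contradiction (subst (IsMaximalZIrSet G) (∣p∣≡1⇒p≡⁅x⁆ ∣S∣≡ u∈S) S-max) (singleton-notMaximal G δ≥2)
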